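{- Let $w_1\ge\dots\ge w_n\ge 1$ be integers with greatest common divisor $1$, let $\Omega=\sum_{i=1}^n w_i$, and let $\bar q\in(0,1)$ be rational. (a) For a positive integer $r$ let $\chi$ be the weighted game $[\bar q(\Omega+r);w_1,\dots,w_n,1^r]$ with $n+r$ players, the last $r$ of weight $1$. If $r\ge \max\!\left(\Omega,\frac{2+w_1}{1-\bar q}\right)$, then $\nu(\chi)=\left\lceil\frac{1}{1-q^r}\right\rceil$, where $q^r=\frac{\lceil \bar q(\Omega+r)\rceil}{\Omega+r}$. (b) For a positive integer $r$ let $\chi$ be the weighted game $[\bar q\,\Omega r;w_1^r,\dots,w_n^r]$ in which each weight $w_i$ is given to $r$ players ($nr$ players in total). There is $R$ such that for all $r\ge R$, $\nu(\chi)=\left\lceil\frac{1}{1-q^r}\right\rceil$, where $q^r=\frac{\lceil \bar q\,\Omega r\rceil}{\Omega r}$.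
   Context: A weighted game $[q;v_1,\dots,v_m]$ has players $1,\dots,m$ with weights $v_i\ge0$, and a coalition $S$ is winning iff $\sum_{i\in S}v_i\ge q$. The Nakamura number $\nu$ of a simple game is the minimum number of winning coalitions with empty intersection ($\infty$ if none exists). -}

module Defs where

open import Data.Nat as ℕ using (ℕ)
open import Data.Nat.GCD using (gcd)
open import Data.Integer as ℤ using (ℤ; +_)
open import Data.Rational as ℚ using (ℚ; 0ℚ; 1/_; _/_)
open import Data.Rational.Properties using (_≟_)
open import Data.Fin using (Fin)
open import Data.Fin.Subset using (Subset; _∈_; ⋂; Empty)
open import Data.Vec as Vec using (Vec; []; _∷_)
open import Data.List as List using (List; length)
open import Data.List.Relation.Unary.All using (All)
open import Data.Product using (_×_)
open import Relation.Nullary using (yes; no; ¬_)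
open import Relation.Binary.PropositionalEquality using (_≡_)
open import Data.Bool using (true; false)

ℕtoℚ : ℕ → ℚ
ℕtoℚ n = (+ n) / 1

-- total reciprocal (1/p for p ≠ 0; value 0 at 0, never used there below)
recip : ℚ → ℚ
recip p with p ≟ 0ℚ
... | yes _ = 0ℚ
... | no p≢0 = (1/ p) {{ℚ.≢-nonZero p≢0}}

_÷'_ : ℚ → ℚ → ℚ
p ÷' q = p ℚ.* recip q

sumV : ∀ {m} → Vec ℕ m → ℕ
sumV = Vec.foldr _ ℕ._+_ 0

-- gcd of a vector of naturals (gcd of empty vector is 0)
gcdV : ∀ {m} → Vec ℕ m → ℕ
gcdV = Vec.foldr _ gcd 0

record WeightedGame (m : ℕ) : Set where
  constructor [_⨾_]
  field
    quota   : ℚ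
    weights : Vec ℕ m

weightOf : ∀ {m} → Vec ℕ m → Subset m → ℕ
weightOf [] [] = 0
weightOf (v ∷ vs) (true ∷ S) = v ℕ.+ weightOf vs S
weightOf (v ∷ vs) (false ∷ S) = weightOf vs S

Winning : ∀ {m} → WeightedGame m → Subset m → Set
Winning G S = WeightedGame.quota G ℚ.≤ ℕtoℚ (weightOf (WeightedGame.weights G) S)

data ℕ∞ : Set where
  fin : ℕ → ℕ∞
  ∞   : ℕ∞

WinningEmptyFamily : ∀ {m} → WeightedGame m → List (Subset m) → Set
WinningEmptyFamily G Ss = All (Winning G) Ss × Empty (⋂ Ss)

data NakamuraIs {m} (G : WeightedGame m) : ℕ∞ → Set where
  nak-fin : (k : ℕ) →
            (Ss : List (Subset m)) → WinningEmptyFamily G Ss → length Ss ≡ k →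
            (∀ Ts → WinningEmptyFamily G Ts → k ℕ.≤ length Ts) →
            NakamuraIs G (fin k)
  nak-∞   : (∀ Ts → ¬ WinningEmptyFamily G Ts) → NakamuraIs G ∞

{-# OPTIONS --safe #-}
module Submission where

-- Let T be the total weight, Q = ⌈q̄ T⌉ the quota rounded up and D = T − Q, so that
-- q^r = Q / T and ⌈1 / (1 − q^r)⌉ = ⌈T / D⌉.  A coalition wins iff its complement weighs
-- at most D.  The complements of a family of coalitions with empty intersection cover all
-- players, so such a family of winning coalitions has at least ⌈T / D⌉ members; conversely,
-- if the players can be packed into k = ⌈T / D⌉ bins of weight at most D, the complements
-- of the bins are k winning coalitions with empty intersection.  It remains to pack.
-- (a) The hypothesis on r makes every weight at most D.  Next fit fills the bins it closes
--     more than half on average, so it puts the heavy players into fewer than k bins as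
--     r ≥ Ω, and the r players of weight 1 fill the remaining capacity.
-- (b) Let t = ⌈T / k⌉ ≤ D, which grows linearly in r.  As the weights are coprime, Bézout's
--     identity writes t = Σ wᵢ cᵢ with cᵢ ≤ t / Ω + O(1), so (k − 1) cᵢ ≤ r once r is large.
--     Bins 1, …, k − 1 receive cᵢ copies of each wᵢ (weight t) and bin 0 the remaining
--     copies (weight T − (k − 1) t ≤ t).

open import Defs
open import Data.Bool as Bool using (true; false; if_then_else_)
open import Data.Empty using (⊥-elim)
open import Data.Fin as Fin using (Fin)
open import Data.Fin.Subset using (Subset; _∈_; ⋂; Empty; ∁; _∩_; ⊤)
open import Data.Fin.Subset.Properties using (x∈p∩q⁻; x∈∁p⇒x∉p)
open import Data.List as List using (List; []; _∷_; length; applyUpTo)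
open import Data.List.Properties using (length-applyUpTo)
import Data.List.Relation.Unary.All as ListAll
open import Data.List.Relation.Unary.All.Properties using (applyUpTo⁺₁; applyUpTo⁻)
open import Data.Nat as ℕ
  using (ℕ; zero; suc; _+_; _*_; _∸_; _≤_; _<_; _≡ᵇ_; _≤?_; z≤n; s≤s; z<s; NonZero; >-nonZero)
open import Data.Nat.Coprimality using (Coprime)
open import Data.Nat.DivMod using (_%_; m≡m%n+[m/n]*n; m%n<n) renaming (_/_ to _div_)
open import Data.Nat.GCD using (gcd; gcd-GCD; module Bézout)
open import Data.Nat.ListAction using (sum)
open import Data.Nat.Properties
open import Algebra.Properties.CommutativeSemigroup +-commutativeSemigroup using (x∙yz≈y∙xz)
open import Data.Nat.Tactic.RingSolver using (solve-∀)
open import Data.Product using (∃; _×_; _,_; ∃-syntax; proj₁; proj₂; map₂)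
open import Data.Vec as Vec using (Vec; []; _∷_; lookup; head; map; replicate; _++_; truncate; concat)
open import Data.Vec.Properties using (map-id)
open import Data.Vec.Relation.Unary.All as All using (All; []; _∷_; universal)
open import Data.Vec.Relation.Unary.All.Properties using (lookup⁺; lookup⁻; ++⁺; map⁺; concat⁺)
open import Function.Bundles using (_⇔_; mk⇔; Equivalence)
open import Function.Properties.Equivalence using () renaming (trans to ⇔-trans)
open import Relation.Binary.PropositionalEquality
open import Relation.Nullary using (Dec; yes; no; contradiction)

CeilDiv : ℕ → ℕ → ℕ → Set
CeilDiv n d k = n ≤ k * d × k * d < n + d

ceilDiv : ∀ n d .{{_ : NonZero d}} → ∃ (CeilDiv n d)
ceilDiv n d@(suc d₋) = (n + d₋) div d , n≤kd , kd<n+d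
  where
    open ≤-Reasoning
    k = (n + d₋) div d
    rem = (n + d₋) % d
    split : n + d₋ ≡ rem + k * d
    split = m≡m%n+[m/n]*n (n + d₋) d
    n≤kd : n ≤ k * d
    n≤kd = +-cancelʳ-≤ d₋ n (k * d) (begin
      n + d₋      ≡⟨ split ⟩
      rem + k * d ≤⟨ +-monoˡ-≤ (k * d) (≤-pred (m%n<n (n + d₋) d)) ⟩
      d₋ + k * d  ≡⟨ +-comm d₋ (k * d) ⟩
      k * d + d₋  ∎)
    kd<n+d : k * d < n + d
    kd<n+d = begin-strict
      k * d       ≤⟨ m≤n+m (k * d) rem ⟩
      rem + k * d ≡⟨ split ⟨
      n + d₋      <⟨ +-monoʳ-< n ≤-refl ⟩
      n + d       ∎

ceilDiv-least : ∀ {n d k} L → CeilDiv n d k → n ≤ L * d → k ≤ L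
ceilDiv-least {n} {d} {k} L (_ , kd<n+d) n≤Ld = ≤-pred (*-cancelʳ-< d k (suc L) (begin-strict
  k * d     <⟨ kd<n+d ⟩
  n + d     ≤⟨ +-monoˡ-≤ d n≤Ld ⟩
  L * d + d ≡⟨ +-comm (L * d) d ⟩
  suc L * d ∎))
  where open ≤-Reasoning

ceilDiv-unique : ∀ {n d k k′} → CeilDiv n d k → CeilDiv n d k′ → k ≡ k′
ceilDiv-unique ceil ceil′ = ≤-antisym (ceilDiv-least _ ceil (proj₁ ceil′)) (ceilDiv-least _ ceil′ (proj₁ ceil))

ceilDiv-pos : ∀ {n d k} → 1 ≤ n → CeilDiv n d k → 1 ≤ k
ceilDiv-pos {k = zero}  1≤n (n≤0 , _) = contradiction (≤-trans 1≤n n≤0) λ ()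
ceilDiv-pos {k = suc _} _   _         = s≤s z≤n

ceilDiv-≤⇔ : ∀ {n d k} → CeilDiv n d k → ∀ W → n ≤ W * d ⇔ k ≤ W
ceilDiv-≤⇔ {d = d} ceil W = mk⇔ (ceilDiv-least W ceil) (λ k≤W → ≤-trans (proj₁ ceil) (*-monoˡ-≤ d k≤W))

ceilDiv≤2* : ∀ {n D k} d → 1 ≤ D → n < d * suc D → CeilDiv n D k → k ≤ 2 * d
ceilDiv≤2* {n} {D} {k} d 1≤D n<d[1+D] (_ , kD<n+D) = ≤-pred (*-cancelʳ-< D k (suc (2 * d)) (begin-strict
  k * D               <⟨ kD<n+D ⟩
  n + D               ≤⟨ +-monoˡ-≤ D (<⇒≤ n<d[1+D]) ⟩
  d * suc D + D       ≡⟨ regroup d D ⟩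
  d + (d * D + D)     ≤⟨ +-monoˡ-≤ (d * D + D) (m≤m*n d D) ⟩
  d * D + (d * D + D) ≡⟨ regroup′ d D ⟩
  suc (2 * d) * D     ∎))
  where
    open ≤-Reasoning
    instance _ = >-nonZero 1≤D
    regroup : ∀ d D → d * suc D + D ≡ d + (d * D + D)
    regroup = solve-∀
    regroup′ : ∀ d D → d * D + (d * D + D) ≡ suc (2 * d) * D
    regroup′ = solve-∀

weightOf-∁ : ∀ {N} (v : Vec ℕ N) S → weightOf v (∁ S) + weightOf v S ≡ sumV v
weightOf-∁ []      []         = refl
weightOf-∁ (x ∷ v) (true ∷ S)  = trans (x∙yz≈y∙xz (weightOf v (∁ S)) x _) (cong (x +_) (weightOf-∁ v S))
weightOf-∁ (x ∷ v) (false ∷ S) = trans (+-assoc x _ _) (cong (x +_) (weightOf-∁ v S))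

weightOf-empty : ∀ {N} (v : Vec ℕ N) {S} → Empty S → weightOf v S ≡ 0
weightOf-empty []      {[]}        _ = refl
weightOf-empty (x ∷ v) {true ∷ S}  e = ⊥-elim (e (Fin.zero , Vec.here))
weightOf-empty (x ∷ v) {false ∷ S} e = weightOf-empty v (λ (i , i∈S) → e (Fin.suc i , Vec.there i∈S))

weightOf-∁-empty : ∀ {N} (v : Vec ℕ N) {S} → Empty S → weightOf v (∁ S) ≡ sumV v
weightOf-∁-empty v {S} empty = begin
  weightOf v (∁ S)                ≡⟨ +-identityʳ _ ⟨
  weightOf v (∁ S) + 0            ≡⟨ cong (weightOf v (∁ S) +_) (weightOf-empty v empty) ⟨
  weightOf v (∁ S) + weightOf v S ≡⟨ weightOf-∁ v S ⟩
  sumV v                          ∎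
  where open ≡-Reasoning

weightOf-∁⊤ : ∀ {N} (v : Vec ℕ N) → weightOf v (∁ ⊤) ≡ 0
weightOf-∁⊤ []      = refl
weightOf-∁⊤ (x ∷ v) = weightOf-∁⊤ v

weightOf-∁-∩ : ∀ {N} (v : Vec ℕ N) A B →
  weightOf v (∁ (A ∩ B)) ≤ weightOf v (∁ A) + weightOf v (∁ B)
weightOf-∁-∩ []      []         []         = z≤n
weightOf-∁-∩ (x ∷ v) (true ∷ A)  (true ∷ B)  = weightOf-∁-∩ v A B
weightOf-∁-∩ (x ∷ v) (true ∷ A)  (false ∷ B) =
  ≤-trans (+-monoʳ-≤ x (weightOf-∁-∩ v A B)) (≤-reflexive (x∙yz≈y∙xz x (weightOf v (∁ A)) _))
weightOf-∁-∩ (x ∷ v) (false ∷ A) (true ∷ B)  =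
  ≤-trans (+-monoʳ-≤ x (weightOf-∁-∩ v A B)) (≤-reflexive (sym (+-assoc x _ _)))
weightOf-∁-∩ (x ∷ v) (false ∷ A) (false ∷ B) =
  ≤-trans (+-monoʳ-≤ x (weightOf-∁-∩ v A B))
    (≤-trans (≤-reflexive (sym (+-assoc x _ _))) (+-monoʳ-≤ (x + _) (m≤n+m _ x)))

weightOf-∁-⋂ : ∀ {N} (v : Vec ℕ N) Ss →
  weightOf v (∁ (⋂ Ss)) ≤ sum (List.map (λ S → weightOf v (∁ S)) Ss)
weightOf-∁-⋂ v []       = ≤-reflexive (weightOf-∁⊤ v)
weightOf-∁-⋂ v (S ∷ Ss) = ≤-trans (weightOf-∁-∩ v S (⋂ Ss)) (+-monoʳ-≤ _ (weightOf-∁-⋂ v Ss))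

sumV-++ : ∀ {m n} (v : Vec ℕ m) (v′ : Vec ℕ n) → sumV (v ++ v′) ≡ sumV v + sumV v′
sumV-++ []      v′ = refl
sumV-++ (x ∷ v) v′ = trans (cong (x +_) (sumV-++ v v′)) (sym (+-assoc x _ _))

sumV-replicate : ∀ n x → sumV (replicate n x) ≡ n * x
sumV-replicate zero    x = refl
sumV-replicate (suc n) x = cong (x +_) (sumV-replicate n x)

sumV-concat-replicate : ∀ {n} r (w : Vec ℕ n) → sumV (concat (map (replicate r) w)) ≡ sumV w * r
sumV-concat-replicate r []      = refl
sumV-concat-replicate r (x ∷ w) = begin
  sumV (replicate r x ++ concat (map (replicate r) w))
    ≡⟨ sumV-++ (replicate r x) _ ⟩
  sumV (replicate r x) + sumV (concat (map (replicate r) w))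
    ≡⟨ cong₂ _+_ (trans (sumV-replicate r x) (*-comm r x)) (sumV-concat-replicate r w) ⟩
  x * r + sumV w * r
    ≡⟨ *-distribʳ-+ r x (sumV w) ⟨
  (x + sumV w) * r
    ∎
  where open ≡-Reasoning

complementary-≤ : ∀ {a b Q D} → a + b ≡ Q + D → Q ≤ b ⇔ a ≤ D
complementary-≤ {a} {b} {Q} {D} a+b≡Q+D = mk⇔
  (λ Q≤b → +-cancelʳ-≤ b a D (begin
    a + b ≡⟨ a+b≡Q+D ⟩
    Q + D ≤⟨ +-monoˡ-≤ D Q≤b ⟩
    b + D ≡⟨ +-comm b D ⟩
    D + b ∎))
  (λ a≤D → +-cancelˡ-≤ a Q b (begin
    a + Q ≡⟨ +-comm a Q ⟩
    Q + a ≤⟨ +-monoʳ-≤ Q a≤D ⟩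
    Q + D ≡⟨ a+b≡Q+D ⟨
    a + b ∎))
  where open ≤-Reasoning

heavy⇒light∁ : ∀ {N} (v : Vec ℕ N) {Q D} → sumV v ≡ Q + D → ∀ S →
  Q ≤ weightOf v S → weightOf v (∁ S) ≤ D
heavy⇒light∁ v sum≡ S = Equivalence.to (complementary-≤ (trans (weightOf-∁ v S) sum≡))

light⇒heavy∁ : ∀ {N} (v : Vec ℕ N) {Q D} → sumV v ≡ Q + D → ∀ S →
  weightOf v S ≤ D → Q ≤ weightOf v (∁ S)
light⇒heavy∁ v sum≡ S = Equivalence.from
  (complementary-≤ (trans (+-comm (weightOf v S) (weightOf v (∁ S))) (trans (weightOf-∁ v S) sum≡)))

HasQuota : ∀ {N} → WeightedGame N → ℕ → Set
HasQuota G Q = ∀ S → Winning G S ⇔ Q ≤ weightOf (WeightedGame.weights G) S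

sum≤length* : ∀ {A : Set} (f : A → ℕ) {D} {xs : List A} → ListAll.All (λ x → f x ≤ D) xs →
  sum (List.map f xs) ≤ length xs * D
sum≤length* f ListAll.[]         = z≤n
sum≤length* f (fx≤D ListAll.∷ p) = +-mono-≤ fx≤D (sum≤length* f p)

winningEmptyFamily⇒sumV≤ : ∀ {N} {x} {v : Vec ℕ N} {Q D Ss} →
  HasQuota [ x ⨾ v ] Q → sumV v ≡ Q + D → WinningEmptyFamily [ x ⨾ v ] Ss →
  sumV v ≤ length Ss * D
winningEmptyFamily⇒sumV≤ {x = x} {v} {D = D} {Ss} quota sum≡ (winning , empty) = begin
  sumV v                                     ≡⟨ sym (weightOf-∁-empty v empty) ⟩
  weightOf v (∁ (⋂ Ss))                      ≤⟨ weightOf-∁-⋂ v Ss ⟩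
  sum (List.map (λ S → weightOf v (∁ S)) Ss) ≤⟨ sum≤length* _ (ListAll.map light∁ winning) ⟩
  length Ss * D                              ∎
  where
    open ≤-Reasoning
    light∁ : ∀ {S} → Winning [ x ⨾ v ] S → weightOf v (∁ S) ≤ D
    light∁ {S} w = heavy⇒light∁ v sum≡ S (Equivalence.to (quota S) w)

-- Packings into bins and the Nakamura number

inBin : ∀ {N} → Vec ℕ N → ℕ → Subset N
inBin bins j = map (_≡ᵇ j) bins

load : ∀ {N} → Vec ℕ N → Vec ℕ N → ℕ → ℕ
load v bins j = weightOf v (inBin bins j)

record Packing {N} (v : Vec ℕ N) (k : ℕ) (cap : ℕ → ℕ) : Set where
  field
    bins   : Vec ℕ N
    bins<k : All (_< k) bins
    load≤  : ∀ j → load v bins j ≤ cap j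

≡ᵇ-refl : ∀ n → (n ≡ᵇ n) ≡ true
≡ᵇ-refl zero    = refl
≡ᵇ-refl (suc n) = ≡ᵇ-refl n

≢⇒≡ᵇ≡false : ∀ {m n} → m ≢ n → (m ≡ᵇ n) ≡ false
≢⇒≡ᵇ≡false {m} {n} m≢n with m ≡ᵇ n in eq
... | true  = contradiction (≡ᵇ⇒≡ m n (subst Bool.T (sym eq) _)) m≢n
... | false = refl

∈inBin-lookup : ∀ {N} (bins : Vec ℕ N) i → i ∈ inBin bins (lookup bins i)
∈inBin-lookup (b ∷ bins) Fin.zero    rewrite ≡ᵇ-refl b = Vec.here
∈inBin-lookup (b ∷ bins) (Fin.suc i) = Vec.there (∈inBin-lookup bins i)

∈⋂⁻ : ∀ {N} {i : Fin N} Ss → i ∈ ⋂ Ss → ListAll.All (i ∈_) Ss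
∈⋂⁻ []       _    = ListAll.[]
∈⋂⁻ (S ∷ Ss) i∈⋂ with x∈p∩q⁻ S (⋂ Ss) i∈⋂
... | i∈S , i∈⋂Ss = i∈S ListAll.∷ ∈⋂⁻ Ss i∈⋂Ss

packing⇒nakamuraIs : ∀ {N} {x} {v : Vec ℕ N} {Q D k} →
  HasQuota [ x ⨾ v ] Q → sumV v ≡ Q + D → CeilDiv (sumV v) D k → Packing v k (λ _ → D) →
  NakamuraIs [ x ⨾ v ] (fin k)
packing⇒nakamuraIs {x = x} {v} {k = k} quota sum≡ ceil packing =
  nak-fin k Ss (winning , empty) (length-applyUpTo coBin k) minimal
  where
    open Packing packing
    coBin : ℕ → Subset _
    coBin j = ∁ (inBin bins j)
    Ss = applyUpTo coBin k
    winning : ListAll.All (Winning [ x ⨾ v ]) Ss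
    winning = applyUpTo⁺₁ coBin k λ {j} _ →
      Equivalence.from (quota (coBin j)) (light⇒heavy∁ v sum≡ (inBin bins j) (load≤ j))
    empty : Empty (⋂ Ss)
    empty (i , i∈⋂) = x∈∁p⇒x∉p (applyUpTo⁻ coBin k (∈⋂⁻ Ss i∈⋂) (lookup⁺ bins<k i)) (∈inBin-lookup bins i)
    minimal : ∀ Ts → WinningEmptyFamily [ x ⨾ v ] Ts → k ≤ length Ts
    minimal Ts family = ceilDiv-least (length Ts) ceil (winningEmptyFamily⇒sumV≤ {v = v} quota sum≡ family)

load-∷ : ∀ {N} x (v : Vec ℕ N) b bins j →
  load (x ∷ v) (b ∷ bins) j ≡ (if b ≡ᵇ j then x else 0) + load v bins j
load-∷ x v b bins j with b ≡ᵇ j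
... | true  = refl
... | false = refl

load-∷-here : ∀ {N} x (v : Vec ℕ N) b bins → load (x ∷ v) (b ∷ bins) b ≡ x + load v bins b
load-∷-here x v b bins rewrite ≡ᵇ-refl b = refl

load-∷-there : ∀ {N} x (v : Vec ℕ N) {b} bins {j} → b ≢ j → load (x ∷ v) (b ∷ bins) j ≡ load v bins j
load-∷-there x v {b} bins {j} b≢j rewrite ≢⇒≡ᵇ≡false b≢j = refl

load-beyond : ∀ {N} (v : Vec ℕ N) {bins j} → All (_< j) bins → load v bins j ≡ 0
load-beyond []      []             = refl
load-beyond (x ∷ v) (b<j ∷ bins<j) = trans (load-∷-there x v _ (<⇒≢ b<j)) (load-beyond v bins<j)

load-++ : ∀ {m n} (v : Vec ℕ m) (v′ : Vec ℕ n) a a′ j →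
  load (v ++ v′) (a ++ a′) j ≡ load v a j + load v′ a′ j
load-++ []      v′ []      a′ j = refl
load-++ (x ∷ v) v′ (b ∷ a) a′ j with b ≡ᵇ j
... | true  = trans (cong (x +_) (load-++ v v′ a a′ j)) (sym (+-assoc x _ _))
... | false = load-++ v v′ a a′ j

count : ∀ {n} → Vec ℕ n → ℕ → ℕ
count {n} a j = load (replicate n 1) a j

count-++ : ∀ {m n} (a : Vec ℕ m) (a′ : Vec ℕ n) j → count (a ++ a′) j ≡ count a j + count a′ j
count-++ []      a′ j = refl
count-++ (b ∷ a) a′ j with b ≡ᵇ j
... | true  = cong suc (count-++ a a′ j)
... | false = count-++ a a′ j

load-replicate : ∀ {n} x (a : Vec ℕ n) j → load (replicate n x) a j ≡ x * count a j
load-replicate x []      j = sym (*-zeroʳ x)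
load-replicate x (b ∷ a) j with b ≡ᵇ j
... | true  = trans (cong (x +_) (load-replicate x a j)) (sym (*-suc x _))
... | false = load-replicate x a j

-- Next fit

record NextFit (D : ℕ) {N} (v : Vec ℕ N) : Set where
  field
    bins           : Vec ℕ N
    open-bin       : ℕ
    bins≤          : All (_≤ open-bin) bins
    load≤          : ∀ j → load v bins j ≤ D
    -- a closed bin together with the item that did not fit into it weighs more than D
    open-bin-bound : open-bin * suc D + load v bins open-bin ≤ 2 * sumV v

module _ {D N : ℕ} (x : ℕ) {v : Vec ℕ N} (nextFit-v : NextFit D v) where
  open NextFit nextFit-v renaming (open-bin to c)
  open ≤-Reasoning

  put-in-open-bin : load v bins c + x ≤ D → NextFit D (x ∷ v)
  put-in-open-bin fits = record
    { bins           = c ∷ bins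
    ; open-bin       = c
    ; bins≤          = ≤-refl ∷ bins≤
    ; load≤          = load≤′
    ; open-bin-bound = begin
        c * suc D + load (x ∷ v) (c ∷ bins) c ≡⟨ cong (c * suc D +_) (load-∷-here x v c bins) ⟩
        c * suc D + (x + load v bins c)       ≡⟨ x∙yz≈y∙xz (c * suc D) x _ ⟩
        x + (c * suc D + load v bins c)       ≤⟨ +-mono-≤ (m≤m+n x (x + 0)) open-bin-bound ⟩
        2 * x + 2 * sumV v                    ≡⟨ *-distribˡ-+ 2 x (sumV v) ⟨
        2 * sumV (x ∷ v)                      ∎
    }
    where
      load≤′ : ∀ j → load (x ∷ v) (c ∷ bins) j ≤ D
      load≤′ j with c ≟ j
      ... | yes refl = ≤-trans (≤-reflexive (trans (load-∷-here x v c bins) (+-comm x _))) fits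
      ... | no c≢j   = ≤-trans (≤-reflexive (load-∷-there x v bins c≢j)) (load≤ j)

  put-in-new-bin : x ≤ D → D < load v bins c + x → NextFit D (x ∷ v)
  put-in-new-bin x≤D overflow = record
    { bins           = suc c ∷ bins
    ; open-bin       = suc c
    ; bins≤          = ≤-refl ∷ All.map m≤n⇒m≤1+n bins≤
    ; load≤          = load≤′
    ; open-bin-bound = begin
        suc c * suc D + load (x ∷ v) (suc c ∷ bins) (suc c) ≡⟨ cong (suc c * suc D +_) load-new ⟩
        suc D + c * suc D + x                               ≤⟨ +-monoˡ-≤ x (+-monoˡ-≤ (c * suc D) overflow) ⟩
        load v bins c + x + c * suc D + x                   ≡⟨ regroup (load v bins c) x (c * suc D) ⟩
        2 * x + (c * suc D + load v bins c)                 ≤⟨ +-monoʳ-≤ (2 * x) open-bin-bound ⟩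
        2 * x + 2 * sumV v                                  ≡⟨ *-distribˡ-+ 2 x (sumV v) ⟨
        2 * sumV (x ∷ v)                                    ∎
    }
    where
      regroup : ∀ l x a → l + x + a + x ≡ 2 * x + (a + l)
      regroup = solve-∀
      load-new : load (x ∷ v) (suc c ∷ bins) (suc c) ≡ x
      load-new = trans (load-∷-here x v (suc c) bins)
        (trans (cong (x +_) (load-beyond v (All.map s≤s bins≤))) (+-identityʳ x))
      load≤′ : ∀ j → load (x ∷ v) (suc c ∷ bins) j ≤ D
      load≤′ j with suc c ≟ j
      ... | yes refl = ≤-trans (≤-reflexive load-new) x≤D
      ... | no c≢j   = ≤-trans (≤-reflexive (load-∷-there x v bins c≢j)) (load≤ j)

nextFit : ∀ D {N} (v : Vec ℕ N) → All (_≤ D) v → NextFit D v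
nextFit D []      []          =
  record { bins = [] ; open-bin = 0 ; bins≤ = [] ; load≤ = λ _ → z≤n ; open-bin-bound = z≤n }
nextFit D (x ∷ v) (x≤D ∷ v≤D) with nextFit D v v≤D
... | nextFit-v with load v (NextFit.bins nextFit-v) (NextFit.open-bin nextFit-v) + x ≤? D
...   | yes fits    = put-in-open-bin x nextFit-v fits
...   | no overflow = put-in-new-bin x nextFit-v x≤D (≰⇒> overflow)

sumBelow : ℕ → (ℕ → ℕ) → ℕ
sumBelow zero    f = 0
sumBelow (suc k) f = f k + sumBelow k f

sumBelow-cong : ∀ k {f g} → (∀ j → f j ≡ g j) → sumBelow k f ≡ sumBelow k g
sumBelow-cong zero    f≗g = refl
sumBelow-cong (suc k) f≗g = cong₂ _+_ (f≗g k) (sumBelow-cong k f≗g)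

sumBelow-+ : ∀ k f g → sumBelow k (λ j → f j + g j) ≡ sumBelow k f + sumBelow k g
sumBelow-+ zero    f g = refl
sumBelow-+ (suc k) f g = trans (cong (f k + g k +_) (sumBelow-+ k f g)) (+-assoc-comm (f k) (g k) _ _)
  where
    +-assoc-comm : ∀ a b c d → a + b + (c + d) ≡ a + c + (b + d)
    +-assoc-comm = solve-∀

sumBelow-const : ∀ k D → sumBelow k (λ _ → D) ≡ k * D
sumBelow-const zero    D = refl
sumBelow-const (suc k) D = cong (D +_) (sumBelow-const k D)

sumBelow-load : ∀ {N} (v : Vec ℕ N) {bins k} → All (_< k) bins → sumBelow k (load v bins) ≡ sumV v
sumBelow-load []      {k = k} []   = trans (sumBelow-const k 0) (*-zeroʳ k)
sumBelow-load (x ∷ v) {b ∷ bins} {k} (b<k ∷ bins<k) = begin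
  sumBelow k (load (x ∷ v) (b ∷ bins))
    ≡⟨ sumBelow-cong k (load-∷ x v b bins) ⟩
  sumBelow k (λ j → (if b ≡ᵇ j then x else 0) + load v bins j)
    ≡⟨ sumBelow-+ k _ _ ⟩
  sumBelow k (λ j → if b ≡ᵇ j then x else 0) + sumBelow k (load v bins)
    ≡⟨ cong₂ _+_ (sumBelow-single k b<k) (sumBelow-load v bins<k) ⟩
  x + sumV v
    ∎
  where
    open ≡-Reasoning
    sumBelow-none : ∀ k → k ≤ b → sumBelow k (λ j → if b ≡ᵇ j then x else 0) ≡ 0
    sumBelow-none zero    _   = refl
    sumBelow-none (suc k) k<b rewrite ≢⇒≡ᵇ≡false (>⇒≢ k<b) = sumBelow-none k (<⇒≤ k<b)
    sumBelow-single : ∀ k → b < k → sumBelow k (λ j → if b ≡ᵇ j then x else 0) ≡ x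
    sumBelow-single (suc k) b<1+k with b ≟ k
    ... | yes refl rewrite ≡ᵇ-refl b = trans (cong (x +_) (sumBelow-none b ≤-refl)) (+-identityʳ x)
    ... | no b≢k rewrite ≢⇒≡ᵇ≡false b≢k = sumBelow-single k (≤∧≢⇒< (≤-pred b<1+k) b≢k)

count-replicate-here : ∀ m j → count (replicate m j) j ≡ m
count-replicate-here zero    j = refl
count-replicate-here (suc m) j = trans (load-∷-here 1 _ j _) (cong suc (count-replicate-here m j))

count-replicate-there : ∀ m {b j} → b ≢ j → count (replicate m b) j ≡ 0
count-replicate-there zero    b≢j = refl
count-replicate-there (suc m) b≢j = trans (load-∷-there 1 _ _ b≢j) (count-replicate-there m b≢j)

count-truncate : ∀ {m n} (m≤n : m ≤ n) (a : Vec ℕ n) j → count (truncate m≤n a) j ≤ count a j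
count-truncate {zero}  m≤n       a       j = z≤n
count-truncate (s≤s m≤n) (b ∷ a) j with b ≡ᵇ j
... | true  = s≤s (count-truncate m≤n a j)
... | false = count-truncate m≤n a j

replicate⁺ : ∀ {P : ℕ → Set} n {x} → P x → All P (replicate n x)
replicate⁺ zero    px = []
replicate⁺ (suc n) px = px ∷ replicate⁺ n px

truncate⁺ : ∀ {P : ℕ → Set} {m n} (m≤n : m ≤ n) {a : Vec ℕ n} → All P a → All P (truncate m≤n a)
truncate⁺ {m = zero} m≤n       pa         = []
truncate⁺ (s≤s m≤n) (pb ∷ pa) = pb ∷ truncate⁺ m≤n pa

slots : (cap : ℕ → ℕ) (k : ℕ) → Vec ℕ (sumBelow k cap)
slots cap zero    = []
slots cap (suc k) = replicate (cap k) k ++ slots cap k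

slots-< : ∀ cap k → All (_< k) (slots cap k)
slots-< cap zero    = []
slots-< cap (suc k) = ++⁺ (replicate⁺ (cap k) ≤-refl) (All.map m≤n⇒m≤1+n (slots-< cap k))

count-slots : ∀ cap k j → count (slots cap k) j ≤ cap j
count-slots cap zero    j = z≤n
count-slots cap (suc k) j = begin
  count (replicate (cap k) k ++ slots cap k) j          ≡⟨ count-++ (replicate (cap k) k) (slots cap k) j ⟩
  count (replicate (cap k) k) j + count (slots cap k) j ≤⟨ split (k ≟ j) ⟩
  cap j                                                 ∎
  where
    open ≤-Reasoning
    split : Dec (k ≡ j) → count (replicate (cap k) k) j + count (slots cap k) j ≤ cap j
    split (yes refl) = ≤-reflexive (trans
      (cong₂ _+_ (count-replicate-here (cap k) k) (load-beyond (replicate _ 1) (slots-< cap k)))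
      (+-identityʳ (cap k)))
    split (no k≢j)   = ≤-trans
      (≤-reflexive (cong (_+ count (slots cap k) j) (count-replicate-there (cap k) k≢j)))
      (count-slots cap k j)

distribute : ∀ cap k r → r ≤ sumBelow k cap → Packing (replicate r 1) k cap
distribute cap k r r≤ = record
  { bins   = truncate r≤ (slots cap k)
  ; bins<k = truncate⁺ r≤ (slots-< cap k)
  ; load≤  = λ j → ≤-trans (count-truncate r≤ (slots cap k) j) (count-slots cap k j)
  }

packing-with-units : ∀ {N} (w : Vec ℕ N) r {D k} → All (_≤ D) w → 1 ≤ k →
  2 * sumV w ≤ k * D → sumV w + r ≤ k * D → Packing (w ++ replicate r 1) k (λ _ → D)
packing-with-units w r {D} {k} w≤D 1≤k 2Ω≤kD Ω+r≤kD = record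
  { bins   = bins ++ units
  ; bins<k = ++⁺ heavy<k units<k
  ; load≤  = λ j → begin
      load (w ++ replicate r 1) (bins ++ units) j ≡⟨ load-++ w (replicate r 1) bins units j ⟩
      load w bins j + count units j               ≤⟨ +-monoʳ-≤ (load w bins j) (units≤ j) ⟩
      load w bins j + (D ∸ load w bins j)         ≡⟨ m+[n∸m]≡n (load≤ j) ⟩
      D                                           ∎
  }
  where
    open ≤-Reasoning
    open NextFit (nextFit D w w≤D)
    c<k : open-bin < k
    c<k = *-cancelʳ-< (suc D) open-bin k (begin-strict
      open-bin * suc D                        ≤⟨ m≤m+n _ _ ⟩
      open-bin * suc D + load w bins open-bin ≤⟨ open-bin-bound ⟩
      2 * sumV w                              ≤⟨ 2Ω≤kD ⟩
      k * D                                   <⟨ *-monoʳ-< k ≤-refl ⟩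
      k * suc D                               ∎)
      where instance _ = >-nonZero 1≤k
    heavy<k : All (_< k) bins
    heavy<k = All.map (λ b≤c → ≤-<-trans b≤c c<k) bins≤
    free : ℕ → ℕ
    free j = D ∸ load w bins j
    r≤free : r ≤ sumBelow k free
    r≤free = +-cancelʳ-≤ (sumV w) r (sumBelow k free) (begin
      r + sumV w                                 ≡⟨ +-comm r (sumV w) ⟩
      sumV w + r                                 ≤⟨ Ω+r≤kD ⟩
      k * D                                      ≡⟨ sumBelow-const k D ⟨
      sumBelow k (λ _ → D)                       ≡⟨ sumBelow-cong k (λ j → m∸n+n≡m (load≤ j)) ⟨
      sumBelow k (λ j → free j + load w bins j)  ≡⟨ sumBelow-+ k free (load w bins) ⟩
      sumBelow k free + sumBelow k (load w bins) ≡⟨ cong (sumBelow k free +_) (sumBelow-load w heavy<k) ⟩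
      sumBelow k free + sumV w                   ∎)
    open Packing (distribute free k r r≤free) renaming (bins to units; bins<k to units<k; load≤ to units≤)

-- Replicated weights

infix 7 _·_
_·_ : ∀ {n} → Vec ℕ n → Vec ℕ n → ℕ
[]      · []       = 0
(x ∷ w) · (c ∷ cs) = x * c + w · cs

·-map-mono : ∀ {n} (w cs : Vec ℕ n) {f g : ℕ → ℕ} → (∀ c → f c ≤ g c) →
  w · map f cs ≤ w · map g cs
·-map-mono []      []       f≤g = z≤n
·-map-mono (x ∷ w) (c ∷ cs) f≤g = +-mono-≤ (*-monoʳ-≤ x (f≤g c)) (·-map-mono w cs f≤g)

load-concat : ∀ {n r} (w cs : Vec ℕ n) (F : ℕ → Vec ℕ r) j →
  load (concat (map (replicate r) w)) (concat (map F cs)) j ≡ w · map (λ c → count (F c) j) cs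
load-concat []      []       F j = refl
load-concat {r = r} (x ∷ w) (c ∷ cs) F j =
  trans (load-++ (replicate r x) _ (F c) _ j) (cong₂ _+_ (load-replicate x (F c) j) (load-concat w cs F j))

·-map-∸ : ∀ {n} (w cs : Vec ℕ n) m {r} → All (λ c → m * c ≤ r) cs →
  w · map (λ c → r ∸ m * c) cs + m * (w · cs) ≡ sumV w * r
·-map-∸ []      []       m []            = *-zeroʳ m
·-map-∸ (x ∷ w) (c ∷ cs) m {r} (mc≤r ∷ p) = begin
  x * (r ∸ m * c) + w · map (λ c → r ∸ m * c) cs + m * (x * c + w · cs)
    ≡⟨ regroup (r ∸ m * c) (w · map (λ c → r ∸ m * c) cs) x m c (w · cs) ⟩
  x * (r ∸ m * c + m * c) + (w · map (λ c → r ∸ m * c) cs + m * (w · cs))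
    ≡⟨ cong₂ _+_ (cong (x *_) (m∸n+n≡m mc≤r)) (·-map-∸ w cs m p) ⟩
  x * r + sumV w * r
    ≡⟨ *-distribʳ-+ r x (sumV w) ⟨
  sumV (x ∷ w) * r ∎
  where
    open ≡-Reasoning
    regroup : ∀ a b x m c d → x * a + b + m * (x * c + d) ≡ x * (a + m * c) + (b + m * d)
    regroup = solve-∀

-- capacity of bin j for the r copies of an item with coefficient c
share : ℕ → ℕ → ℕ → ℕ → ℕ
share r m c zero    = r ∸ m * c
share r m c (suc _) = c

sumBelow-share : ∀ r m c m′ → sumBelow (suc m′) (share r m c) ≡ m′ * c + (r ∸ m * c)
sumBelow-share r m c zero     = +-identityʳ _
sumBelow-share r m c (suc m′) = trans (cong (c +_) (sumBelow-share r m c m′)) (sym (+-assoc c _ _))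

packing-replicated : ∀ {n} (w cs : Vec ℕ n) r {m D} → All (λ c → m * c ≤ r) cs →
  sumV w * r ≤ suc m * (w · cs) → w · cs ≤ D → Packing (concat (map (replicate r) w)) (suc m) (λ _ → D)
packing-replicated w cs r {m} {D} mcs≤r Ωr≤kt t≤D = record
  { bins   = concat (map F cs)
  ; bins<k = concat⁺ (map⁺ (universal (λ c → Packing.bins<k (spread c)) cs))
  ; load≤  = load≤
  }
  where
    open ≤-Reasoning
    spread : ∀ c → Packing (replicate r 1) (suc m) (share r m c)
    spread c = distribute (share r m c) (suc m) r
      (≤-trans (m≤n+m∸n r (m * c)) (≤-reflexive (sym (sumBelow-share r m c m))))
    F : ℕ → Vec ℕ r
    F c = Packing.bins (spread c)
    load≤ : ∀ j → load (concat (map (replicate r) w)) (concat (map F cs)) j ≤ D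
    load≤ j@zero = begin
      load (concat (map (replicate r) w)) (concat (map F cs)) j ≡⟨ load-concat w cs F j ⟩
      w · map (λ c → count (F c) j) cs                          ≤⟨ ·-map-mono w cs (λ c → Packing.load≤ (spread c) j) ⟩
      w · map (λ c → r ∸ m * c) cs                              ≤⟨ +-cancelʳ-≤ (m * (w · cs)) _ _ (begin
        w · map (λ c → r ∸ m * c) cs + m * (w · cs) ≡⟨ ·-map-∸ w cs m mcs≤r ⟩
        sumV w * r                                  ≤⟨ Ωr≤kt ⟩
        w · cs + m * (w · cs)                       ∎) ⟩
      w · cs                                                    ≤⟨ t≤D ⟩
      D                                                         ∎
    load≤ j@(suc _) = begin
      load (concat (map (replicate r) w)) (concat (map F cs)) j ≡⟨ load-concat w cs F j ⟩
      w · map (λ c → count (F c) j) cs                          ≤⟨ ·-map-mono w cs (λ c → Packing.load≤ (spread c) j) ⟩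
      w · map (λ c → c) cs                                      ≡⟨ cong (w ·_) (map-id cs) ⟩
      w · cs                                                    ≤⟨ t≤D ⟩
      D                                                         ∎

·-map-* : ∀ {n} (w v : Vec ℕ n) b → w · map (b *_) v ≡ b * (w · v)
·-map-* []      []      b = sym (*-zeroʳ b)
·-map-* (x ∷ w) (c ∷ v) b = trans (cong (x * (b * c) +_) (·-map-* w v b)) (regroup x b c (w · v))
  where
    regroup : ∀ x b c d → x * (b * c) + b * d ≡ b * (x * c + d)
    regroup = solve-∀

bezout : ∀ {n} (w : Vec ℕ n) → ∃[ u ] ∃[ u′ ] w · u ≡ w · u′ + gcdV w
bezout []      = [] , [] , refl
bezout (x ∷ w) with bezout w | Bézout.identity (gcd-GCD x (gcdV w))
... | u , u′ , eq | Bézout.+- α β d+βg≡αx = α ∷ map (β *_) u′ , 0 ∷ map (β *_) u , (begin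
  x * α + w · map (β *_) u′    ≡⟨ cong₂ _+_ (*-comm x α) (·-map-* w u′ β) ⟩
  α * x + β * (w · u′)         ≡⟨ cong (_+ β * (w · u′)) d+βg≡αx ⟨
  d + β * g + β * (w · u′)     ≡⟨ regroup d β g (w · u′) x ⟩
  x * 0 + β * (w · u′ + g) + d ≡⟨ cong (λ z → x * 0 + β * z + d) eq ⟨
  x * 0 + β * (w · u) + d      ≡⟨ cong (λ z → x * 0 + z + d) (·-map-* w u β) ⟨
  x * 0 + w · map (β *_) u + d ∎)
  where
    open ≡-Reasoning
    g = gcdV w
    d = gcd x g
    regroup : ∀ d β g e x → d + β * g + β * e ≡ x * 0 + β * (e + g) + d
    regroup = solve-∀
... | u , u′ , eq | Bézout.-+ α β d+αx≡βg = 0 ∷ map (β *_) u , α ∷ map (β *_) u′ , (begin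
  x * 0 + w · map (β *_) u      ≡⟨ cong (x * 0 +_) (·-map-* w u β) ⟩
  x * 0 + β * (w · u)           ≡⟨ cong (λ z → x * 0 + β * z) eq ⟩
  x * 0 + β * (w · u′ + g)      ≡⟨ regroup x β (w · u′) g ⟩
  β * (w · u′) + β * g          ≡⟨ cong (β * (w · u′) +_) d+αx≡βg ⟨
  β * (w · u′) + (d + α * x)    ≡⟨ regroup′ β (w · u′) d α x ⟩
  x * α + β * (w · u′) + d      ≡⟨ cong (λ z → x * α + z + d) (·-map-* w u′ β) ⟨
  x * α + w · map (β *_) u′ + d ∎)
  where
    open ≡-Reasoning
    g = gcdV w
    d = gcd x g
    regroup : ∀ x β e g → x * 0 + β * (e + g) ≡ β * e + β * g
    regroup = solve-∀
    regroup′ : ∀ β e d α x → β * e + (d + α * x) ≡ x * α + β * e + d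
    regroup′ = solve-∀

≤sumV : ∀ {n} (v : Vec ℕ n) → All (_≤ sumV v) v
≤sumV []      = []
≤sumV (x ∷ v) = m≤m+n x (sumV v) ∷ All.map (λ c≤ → ≤-trans c≤ (m≤n+m (sumV v) x)) (≤sumV v)

·-zipWith : ∀ {n} (w u u′ : Vec ℕ n) a x y →
  w · Vec.zipWith (λ p q → a + x * p + y * q) u u′ ≡ a * sumV w + x * (w · u) + y * (w · u′)
·-zipWith []      []      []        a x y = regroup a x y
  where
    regroup : ∀ a x y → 0 ≡ a * 0 + x * 0 + y * 0
    regroup = solve-∀
·-zipWith (z ∷ w) (p ∷ u) (q ∷ u′) a x y =
  trans (cong (z * (a + x * p + y * q) +_) (·-zipWith w u u′ a x y)) (regroup z a x y p q (sumV w) (w · u) (w · u′))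
  where
    regroup : ∀ z a x y p q S e e′ → z * (a + x * p + y * q) + (a * S + x * e + y * e′)
            ≡ a * (z + S) + x * (z * p + e) + y * (z * q + e′)
    regroup = solve-∀

representation : ∀ {n} (w u u′ : Vec ℕ n) .{{_ : NonZero (sumV w)}} → w · u ≡ w · u′ + 1 →
  ∀ t → sumV w * (w · u′) ≤ t →
  ∃[ cs ] (w · cs ≡ t × All (λ c → sumV w * c ≤ t + sumV w * (sumV w * (sumV u + sumV u′))) cs)
representation w u u′ wu≡wu′+1 t Ωwu′≤t = cs , w·cs≡t , All.zipWith entry≤
  (All.map (λ p≤ → ≤-trans p≤ (m≤m+n (sumV u) (sumV u′))) (≤sumV u))
  (All.map (λ q≤ → ≤-trans q≤ (m≤n+m (sumV u′) (sumV u))) (≤sumV u′))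
  where
    Ω = sumV w
    E = sumV u + sumV u′
    s = t ∸ Ω * (w · u′)
    a = s div Ω
    x = s % Ω
    y = Ω ∸ x
    x≤Ω : x ≤ Ω
    x≤Ω = <⇒≤ (m%n<n s Ω)
    cs = Vec.zipWith (λ p q → a + x * p + y * q) u u′
    w·cs≡t : w · cs ≡ t
    w·cs≡t = begin
      w · cs                                  ≡⟨ ·-zipWith w u u′ a x y ⟩
      a * Ω + x * (w · u) + y * (w · u′)      ≡⟨ cong (λ z → a * Ω + x * z + y * (w · u′)) wu≡wu′+1 ⟩
      a * Ω + x * (w · u′ + 1) + y * (w · u′) ≡⟨ regroup a Ω x y (w · u′) ⟩
      (x + a * Ω) + (x + y) * (w · u′)
        ≡⟨ cong₂ (λ z z′ → z + z′ * (w · u′)) (sym (m≡m%n+[m/n]*n s Ω)) (m+[n∸m]≡n x≤Ω) ⟩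
      s + Ω * (w · u′) ≡⟨ m∸n+n≡m Ωwu′≤t ⟩
      t                ∎
      where
        open ≡-Reasoning
        regroup : ∀ a Ω x y e → a * Ω + x * (e + 1) + y * e ≡ (x + a * Ω) + (x + y) * e
        regroup = solve-∀
    Ωa≤t : Ω * a ≤ t
    Ωa≤t = ≤-trans (≤-reflexive (*-comm Ω a)) (≤-trans (m≤n+m (a * Ω) x)
             (≤-trans (≤-reflexive (sym (m≡m%n+[m/n]*n s Ω))) (m∸n≤m t (Ω * (w · u′)))))
    entry≤ : ∀ {p q} → p ≤ E → q ≤ E →
      Ω * (a + x * p + y * q) ≤ t + Ω * (Ω * E)
    entry≤ {p} {q} p≤E q≤E = begin
      Ω * (a + x * p + y * q)   ≡⟨ cong (Ω *_) (+-assoc a (x * p) (y * q)) ⟩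
      Ω * (a + (x * p + y * q)) ≤⟨ *-monoʳ-≤ Ω (+-monoʳ-≤ a (+-mono-≤ (*-monoʳ-≤ x p≤E) (*-monoʳ-≤ y q≤E))) ⟩
      Ω * (a + (x * E + y * E)) ≡⟨ cong (λ z → Ω * (a + z)) (*-distribʳ-+ E x y) ⟨
      Ω * (a + (x + y) * E)     ≡⟨ cong (λ z → Ω * (a + z * E)) (m+[n∸m]≡n x≤Ω) ⟩
      Ω * (a + Ω * E)           ≡⟨ *-distribˡ-+ Ω a (Ω * E) ⟩
      Ω * a + Ω * (Ω * E)       ≤⟨ +-monoˡ-≤ (Ω * (Ω * E)) Ωa≤t ⟩
      t + Ω * (Ω * E)           ∎
      where open ≤-Reasoning

share-fits : ∀ {Ω c t B m r} → Ω * c ≤ t + B → suc m * t < Ω * r + suc m → suc m + suc m * B ≤ t → m * c ≤ r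
share-fits {Ω} {c} {t} {B} {m} {r} Ωc≤t+B kt<Ωr+k k+kB≤t = <⇒≤ (*-cancelˡ-< Ω (m * c) r (begin-strict
  Ω * (m * c) ≡⟨ swap Ω m c ⟩
  m * (Ω * c) ≤⟨ *-monoʳ-≤ m Ωc≤t+B ⟩
  m * (t + B) <⟨ +-cancelˡ-< t (m * (t + B)) (Ω * r) (begin-strict
    t + m * (t + B)             ≡⟨ regroup t m B ⟩
    suc m * t + m * B           ≤⟨ +-monoʳ-≤ (suc m * t) (*-monoˡ-≤ B (n≤1+n m)) ⟩
    suc m * t + suc m * B       <⟨ +-monoˡ-< (suc m * B) kt<Ωr+k ⟩
    Ω * r + suc m + suc m * B   ≡⟨ +-assoc (Ω * r) (suc m) (suc m * B) ⟩
    Ω * r + (suc m + suc m * B) ≤⟨ +-monoʳ-≤ (Ω * r) k+kB≤t ⟩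
    Ω * r + t                   ≡⟨ +-comm (Ω * r) t ⟩
    t + Ω * r                   ∎) ⟩
  Ω * r       ∎))
  where
    open ≤-Reasoning
    swap : ∀ Ω m c → Ω * (m * c) ≡ m * (Ω * c)
    swap = solve-∀
    regroup : ∀ t m B → t + m * (t + B) ≡ suc m * t + m * B
    regroup = solve-∀

-- t ≥ threshold w u u′ K makes `representation` applicable and lets `share-fits` absorb its error
threshold : ∀ {n} → Vec ℕ n → Vec ℕ n → Vec ℕ n → ℕ → ℕ
threshold w u u′ K = sumV w * (w · u′) + (K + K * (sumV w * (sumV w * (sumV u + sumV u′))))

packing-replicated-large : ∀ {n} (w u u′ : Vec ℕ n) K → 1 ≤ sumV w → w · u ≡ w · u′ + 1 →
  ∀ r {k D} → K * threshold w u u′ K ≤ r → 1 ≤ k → k ≤ K → CeilDiv (sumV w * r) D k →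
  Packing (concat (map (replicate r) w)) k (λ _ → D)
packing-replicated-large w u u′ K 1≤Ω wu≡wu′+1 r {suc m} {D} KX≤r _ k≤K (T≤kD , _) =
  packing-replicated w cs r shares-fit T≤kt (≤-trans (≤-reflexive w·cs≡t) t≤D)
  where
    open ≤-Reasoning
    Ω = sumV w
    T = Ω * r
    k = suc m
    B = Ω * (Ω * (sumV u + sumV u′))
    X = threshold w u u′ K
    instance _ = >-nonZero 1≤Ω
    instance _ = >-nonZero (≤-trans (s≤s z≤n) k≤K)
    t = proj₁ (ceilDiv T k)
    T≤tk : T ≤ t * k
    T≤tk = proj₁ (proj₂ (ceilDiv T k))
    tk<T+k : t * k < T + k
    tk<T+k = proj₂ (proj₂ (ceilDiv T k))
    t≤D : t ≤ D
    t≤D = ≤-pred (*-cancelʳ-< k t (suc D) (begin-strict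
      t * k     <⟨ tk<T+k ⟩
      T + k     ≤⟨ +-monoˡ-≤ k T≤kD ⟩
      k * D + k ≡⟨ trans (+-comm (k * D) k) (cong (k +_) (*-comm k D)) ⟩
      suc D * k ∎))
    X≤t : X ≤ t
    X≤t = *-cancelˡ-≤ K (begin
      K * X ≤⟨ KX≤r ⟩
      r     ≤⟨ m≤n*m r Ω ⟩
      T     ≤⟨ T≤tk ⟩
      t * k ≤⟨ *-monoʳ-≤ t k≤K ⟩
      t * K ≡⟨ *-comm t K ⟩
      K * t ∎)
    represented = representation w u u′ wu≡wu′+1 t (≤-trans (m≤m+n _ _) X≤t)
    cs = proj₁ represented
    w·cs≡t : w · cs ≡ t
    w·cs≡t = proj₁ (proj₂ represented)
    shares-fit : All (λ c → m * c ≤ r) cs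
    shares-fit = All.map
      (λ Ωc≤t+B → share-fits {Ω} Ωc≤t+B (subst (_< T + k) (*-comm t k) tk<T+k)
         (≤-trans (+-mono-≤ k≤K (*-monoˡ-≤ B k≤K)) (≤-trans (m≤n+m _ (Ω * (w · u′))) X≤t)))
      (proj₂ (proj₂ represented))
    T≤kt : Ω * r ≤ k * (w · cs)
    T≤kt = ≤-trans T≤tk (≤-reflexive (trans (*-comm t k) (cong (k *_) (sym w·cs≡t))))

-- Rational arithmetic through unnormalised fractions

open import Data.Integer as ℤ using (ℤ; +_; +[1+_]; -[1+_])
import Data.Integer.Properties as ℤ
open import Data.Rational as ℚ using (ℚ; mkℚ; 0ℚ; 1ℚ; _/_; _-_; ceiling; toℚᵘ)
import Data.Rational.Properties as ℚ
open import Data.Rational.Unnormalised as ℚᵘ using (ℚᵘ; mkℚᵘ)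
import Data.Rational.Unnormalised.Properties as ℚᵘ

-- frac n e = n / (1 + e)
frac : ℕ → ℕ → ℚᵘ
frac n e = mkℚᵘ (+ n) e

pos-*-injective : ∀ a b c d → + a ℤ.* + b ≡ + c ℤ.* + d → a * b ≡ c * d
pos-*-injective a b c d eq = ℤ.+-injective (trans (ℤ.pos-* a b) (trans eq (sym (ℤ.pos-* c d))))

frac-≤⁻ : ∀ {a b c e} → frac a b ℚᵘ.≤ frac c e → a * suc e ≤ c * suc b
frac-≤⁻ {a} {b} {c} {e} (ℚᵘ.*≤* le) =
  ℤ.drop‿+≤+ (subst₂ ℤ._≤_ (sym (ℤ.pos-* a (suc e))) (sym (ℤ.pos-* c (suc b))) le)

frac-≤⁺ : ∀ {a b c e} → a * suc e ≤ c * suc b → frac a b ℚᵘ.≤ frac c e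
frac-≤⁺ {a} {b} {c} {e} le = ℚᵘ.*≤* (subst₂ ℤ._≤_ (ℤ.pos-* a (suc e)) (ℤ.pos-* c (suc b)) (ℤ.+≤+ le))

frac-*ˡ : ∀ a c e → frac a 0 ℚᵘ.* frac c e ≡ frac (a * c) e
frac-*ˡ a c e = cong₂ mkℚᵘ (sym (ℤ.pos-* a c)) (+-identityʳ e)

frac-*ʳ : ∀ a b c → frac a b ℚᵘ.* frac c 0 ≡ frac (a * c) b
frac-*ʳ a b c = cong₂ mkℚᵘ (sym (ℤ.pos-* a c)) (*-identityʳ b)

1-frac : ∀ {c e} → c ≤ suc e → ℚᵘ.1ℚᵘ ℚᵘ.- frac c e ≡ frac (suc e ∸ c) e
1-frac {c} {e} c≤1+e = cong₂ mkℚᵘ numerator (+-identityʳ e)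
  where
    numerator : + 1 ℤ.* + suc e ℤ.+ (ℤ.- + c) ℤ.* + 1 ≡ + (suc e ∸ c)
    numerator = trans (cong₂ ℤ._+_ (ℤ.*-identityˡ (+ suc e)) (ℤ.*-identityʳ (ℤ.- + c)))
                      (trans (ℤ.m-n≡m⊖n (suc e) c) (ℤ.⊖-≥ c≤1+e))

1/frac : ∀ {v c e} → v ℚᵘ.≃ frac (suc c) e → .{{_ : ℚᵘ.NonZero v}} → ℚᵘ.1/ v ℚᵘ.≃ frac (suc e) c
1/frac {mkℚᵘ +[1+ n ] d} {c} {e} (ℚᵘ.*≡* eq) =
  ℚᵘ.*≡* (trans (ℤ.*-comm +[1+ d ] +[1+ c ]) (trans (sym eq) (ℤ.*-comm +[1+ n ] +[1+ e ])))

toℚᵘ-ℕtoℚ : ∀ n → toℚᵘ (ℕtoℚ n) ℚᵘ.≃ frac n 0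
toℚᵘ-ℕtoℚ n = ℚ.toℚᵘ-fromℚᵘ (frac n 0)

toℚᵘ-* : ∀ {p q u v} → toℚᵘ p ℚᵘ.≃ u → toℚᵘ q ℚᵘ.≃ v → toℚᵘ (p ℚ.* q) ℚᵘ.≃ u ℚᵘ.* v
toℚᵘ-* {p} {q} p≃u q≃v = ℚᵘ.≃-trans (ℚ.toℚᵘ-homo-* p q) (ℚᵘ.*-cong p≃u q≃v)

toℚᵘ-1- : ∀ {q v} → toℚᵘ q ℚᵘ.≃ v → toℚᵘ (1ℚ ℚ.- q) ℚᵘ.≃ ℚᵘ.1ℚᵘ ℚᵘ.- v
toℚᵘ-1- {q} q≃v = ℚᵘ.≃-trans (ℚ.toℚᵘ-homo-+ 1ℚ (ℚ.- q))
  (ℚᵘ.+-cong (ℚᵘ.≃-refl {ℚᵘ.1ℚᵘ}) (ℚᵘ.≃-trans (ℚ.toℚᵘ-homo‿- q) (ℚᵘ.-‿cong q≃v)))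

toℚᵘ-recip : ∀ {p c e} → toℚᵘ p ℚᵘ.≃ frac (suc c) e → toℚᵘ (recip p) ℚᵘ.≃ frac (suc e) c
toℚᵘ-recip {p} {c} {e} p≃ with p ℚ.≟ 0ℚ
... | yes refl with p≃
...   | ℚᵘ.*≡* ()
toℚᵘ-recip {p} {c} {e} p≃ | no p≢0 =
  ℚᵘ.≃-trans (ℚ.toℚᵘ-homo-1/ p {{ℚ.≢-nonZero p≢0}}) (1/frac p≃ {{ℚ.≢-nonZero p≢0}})

toℚᵘ-÷′ : ∀ {p q u c e} → toℚᵘ p ℚᵘ.≃ u → toℚᵘ q ℚᵘ.≃ frac (suc c) e →
  toℚᵘ (p ÷' q) ℚᵘ.≃ u ℚᵘ.* frac (suc e) c
toℚᵘ-÷′ p≃u q≃ = toℚᵘ-* p≃u (toℚᵘ-recip q≃)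

≤⇔frac-≤ : ∀ {x y a b c e} → toℚᵘ x ℚᵘ.≃ frac a b → toℚᵘ y ℚᵘ.≃ frac c e →
  x ℚ.≤ y ⇔ a * suc e ≤ c * suc b
≤⇔frac-≤ x≃ y≃ = mk⇔
  (λ x≤y → frac-≤⁻ (ℚᵘ.≤-respʳ-≃ y≃ (ℚᵘ.≤-respˡ-≃ x≃ (ℚ.toℚᵘ-mono-≤ x≤y))))
  (λ le → ℚ.toℚᵘ-cancel-≤ (ℚᵘ.≤-respʳ-≃ (ℚᵘ.≃-sym y≃) (ℚᵘ.≤-respˡ-≃ (ℚᵘ.≃-sym x≃) (frac-≤⁺ le))))

-- `ceiling` unfolds to the integer division of -[1+ a ], which splits on divisibility.
ceiling-mkℚ : ∀ a f .(coprime : Coprime (suc a) (suc f)) {k} → CeilDiv (suc a) (suc f) k →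
  ceiling (mkℚ +[1+ a ] f coprime) ≡ + k
ceiling-mkℚ a f coprime {k} ceil with suc a % suc f in eq
... | zero  = begin
  ℤ.- (+ 1 ℤ.* ℤ.- (+ (A div F))) ≡⟨ cong ℤ.-_ (ℤ.*-identityˡ (ℤ.- (+ (A div F)))) ⟩
  ℤ.- ℤ.- (+ (A div F))           ≡⟨ ℤ.neg-involutive (+ (A div F)) ⟩
  + (A div F)                     ≡⟨ cong +_ (ceilDiv-unique exact ceil) ⟩
  + k                             ∎
  where
    open ≡-Reasoning
    A = suc a
    F = suc f
    A≡ : A ≡ A div F * F
    A≡ = trans (m≡m%n+[m/n]*n A F) (cong (_+ A div F * F) eq)
    exact : CeilDiv A F (A div F)
    exact = ≤-reflexive A≡ , subst (_< A + F) A≡ (m<m+n A z<s)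
... | suc r = trans (cong ℤ.-_ (ℤ.*-identityˡ -[1+ A div F ])) (cong +_ (ceilDiv-unique rounded ceil))
  where
    A = suc a
    F = suc f
    A≡ : A ≡ suc r + A div F * F
    A≡ = trans (m≡m%n+[m/n]*n A F) (cong (_+ A div F * F) eq)
    r<F : suc r < F
    r<F = subst (_< F) eq (m%n<n A F)
    rounded : CeilDiv A F (suc (A div F))
    rounded =
      subst (_≤ F + A div F * F) (sym A≡) (+-monoˡ-≤ (A div F * F) (<⇒≤ r<F)) ,
      subst (λ z → F + A div F * F < z + F) (sym A≡)
        (subst (_< suc r + A div F * F + F) (+-comm (A div F * F) F) (+-monoˡ-< F (m<n+m (A div F * F) z<s)))

ceiling-≃ : ∀ x {n e k} → toℚᵘ x ℚᵘ.≃ frac n e → 1 ≤ n → CeilDiv n (suc e) k → ceiling x ≡ + k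
ceiling-≃ (mkℚ (+ zero) f _) {suc n} {e} (ℚᵘ.*≡* eq) _ _ with pos-*-injective 0 (suc e) (suc n) (suc f) eq
... | ()
ceiling-≃ (mkℚ -[1+ a ] f _) {n} {e} (ℚᵘ.*≡* eq) _ _ with trans eq (sym (ℤ.pos-* n (suc f)))
... | ()
ceiling-≃ (mkℚ +[1+ a ] f coprime) {n} {e} {k} (ℚᵘ.*≡* eq) _ (n≤ke , ke<n+e) =
  ceiling-mkℚ a f coprime (A≤kF , kF<A+F)
  where
    A = suc a
    F = suc f
    E = suc e
    AE≡nF : A * E ≡ n * F
    AE≡nF = pos-*-injective A E n F eq
    swap : ∀ k E F → k * E * F ≡ k * F * E
    swap = solve-∀
    A≤kF : A ≤ k * F
    A≤kF = *-cancelʳ-≤ A (k * F) E (begin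
      A * E     ≡⟨ AE≡nF ⟩
      n * F     ≤⟨ *-monoˡ-≤ F n≤ke ⟩
      k * E * F ≡⟨ swap k E F ⟩
      k * F * E ∎)
      where open ≤-Reasoning
    kF<A+F : k * F < A + F
    kF<A+F = *-cancelʳ-< E (k * F) (A + F) (begin-strict
      k * F * E     ≡⟨ swap k F E ⟩
      k * E * F     <⟨ *-monoˡ-< F ke<n+e ⟩
      (n + E) * F   ≡⟨ *-distribʳ-+ F n E ⟩
      n * F + E * F ≡⟨ cong (_+ E * F) AE≡nF ⟨
      A * E + E * F ≡⟨ cong (λ z → A * E + z) (*-comm E F) ⟩
      A * E + F * E ≡⟨ *-distribʳ-+ E A F ⟨
      (A + F) * E   ∎)
      where open ≤-Reasoning

quota-≃ : ∀ p d₋ .(coprime : Coprime p (suc d₋)) T →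
  toℚᵘ (mkℚ (+ p) d₋ coprime ℚ.* ℕtoℚ T) ℚᵘ.≃ frac (p * T) d₋
quota-≃ p d₋ coprime T = begin
  toℚᵘ (mkℚ (+ p) d₋ coprime ℚ.* ℕtoℚ T) ≈⟨ toℚᵘ-* ℚᵘ.≃-refl (toℚᵘ-ℕtoℚ T) ⟩
  frac p d₋ ℚᵘ.* frac T 0                ≡⟨ frac-*ʳ p d₋ T ⟩
  frac (p * T) d₋                        ∎
  where open ℚᵘ.≃-Reasoning

ceiling-1÷[1-Q÷T] : ∀ {Q D T k} → Q + D ≡ T → 1 ≤ D → CeilDiv T D k →
  ceiling (1ℚ ÷' (1ℚ ℚ.- (ℕtoℚ Q ÷' ℕtoℚ T))) ≡ + k
ceiling-1÷[1-Q÷T] {Q} {suc D₋} {zero} Q+D≡0 _ _ = contradiction Q+D≡0 (m+1+n≢0 Q)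
ceiling-1÷[1-Q÷T] {Q} {D@(suc D₋)} {T@(suc T₋)} Q+D≡T _ ceil = ceiling-≃ _ 1÷[1-Q÷T]≃ (s≤s z≤n) ceil
  where
    open ℚᵘ.≃-Reasoning
    1-Q÷T≃ : toℚᵘ (1ℚ ℚ.- (ℕtoℚ Q ÷' ℕtoℚ T)) ℚᵘ.≃ frac D T₋
    1-Q÷T≃ = begin
      toℚᵘ (1ℚ ℚ.- (ℕtoℚ Q ÷' ℕtoℚ T))  ≈⟨ toℚᵘ-1- (toℚᵘ-÷′ (toℚᵘ-ℕtoℚ Q) (toℚᵘ-ℕtoℚ T)) ⟩
      ℚᵘ.1ℚᵘ ℚᵘ.- frac Q 0 ℚᵘ.* frac 1 T₋ ≡⟨ cong (λ v → ℚᵘ.1ℚᵘ ℚᵘ.- v) (frac-*ˡ Q 1 T₋) ⟩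
      ℚᵘ.1ℚᵘ ℚᵘ.- frac (Q * 1) T₋         ≡⟨ cong (λ n → ℚᵘ.1ℚᵘ ℚᵘ.- frac n T₋) (*-identityʳ Q) ⟩
      ℚᵘ.1ℚᵘ ℚᵘ.- frac Q T₋               ≡⟨ 1-frac (subst (Q ≤_) Q+D≡T (m≤m+n Q D)) ⟩
      frac (T ∸ Q) T₋                     ≡⟨ cong (λ n → frac n T₋) (trans (cong (_∸ Q) (sym Q+D≡T)) (m+n∸m≡n Q D)) ⟩
      frac D T₋                           ∎
    1÷[1-Q÷T]≃ : toℚᵘ (1ℚ ÷' (1ℚ ℚ.- (ℕtoℚ Q ÷' ℕtoℚ T))) ℚᵘ.≃ frac T D₋
    1÷[1-Q÷T]≃ = begin
      toℚᵘ (1ℚ ÷' (1ℚ ℚ.- (ℕtoℚ Q ÷' ℕtoℚ T))) ≈⟨ toℚᵘ-÷′ (toℚᵘ-ℕtoℚ 1) 1-Q÷T≃ ⟩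
      frac 1 0 ℚᵘ.* frac T D₋                  ≡⟨ trans (frac-*ˡ 1 T D₋) (cong (λ n → frac n D₋) (*-identityˡ T)) ⟩
      frac T D₋                                ∎

-- The theorem for a fixed ratio q̄ = p / d

nakamuraFormula : ℚ → ℕ → ℤ
nakamuraFormula q̄ T = ceiling (1ℚ ÷' (1ℚ ℚ.- ((ceiling (q̄ ℚ.* ℕtoℚ T) ℚ./ 1) ÷' ℕtoℚ T)))

module Ratio (p d₋ : ℕ) .(coprime : Coprime p (suc d₋)) (1≤p : 1 ≤ p) (p≤d₋ : p ≤ d₋) where

  -- q̄ = p / d and 1 − q̄ = (1 + δ) / d
  d δ : ℕ
  d = suc d₋
  δ = d₋ ∸ p

  q̄ : ℚ
  q̄ = mkℚ (+ p) d₋ coprime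

  d≡p+1+δ : d ≡ p + suc δ
  d≡p+1+δ = sym (trans (+-suc p δ) (cong suc (m+[n∸m]≡n p≤d₋)))

  1-q̄≃ : toℚᵘ (1ℚ ℚ.- q̄) ℚᵘ.≃ frac (suc δ) d₋
  1-q̄≃ = begin
    toℚᵘ (1ℚ ℚ.- q̄)      ≈⟨ toℚᵘ-1- {q̄} ℚᵘ.≃-refl ⟩
    ℚᵘ.1ℚᵘ ℚᵘ.- frac p d₋ ≡⟨ 1-frac (m≤n⇒m≤1+n p≤d₋) ⟩
    frac (d ∸ p) d₋       ≡⟨ cong (λ n → frac n d₋) (+-∸-assoc 1 p≤d₋) ⟩
    frac (suc δ) d₋       ∎
    where open ℚᵘ.≃-Reasoning

  hasQuota : ∀ {N} (v : Vec ℕ N) T {Q} → CeilDiv (p * T) d Q → HasQuota [ q̄ ℚ.* ℕtoℚ T ⨾ v ] Q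
  hasQuota v T {Q} ceil S = ⇔-trans
    (≤⇔frac-≤ (quota-≃ p d₋ coprime T) (toℚᵘ-ℕtoℚ (weightOf v S)))
    (subst (λ n → n ≤ weightOf v S * d ⇔ Q ≤ weightOf v S) (sym (*-identityʳ (p * T)))
      (ceilDiv-≤⇔ ceil (weightOf v S)))

  ÷[1-q̄]≤⇒ : ∀ a r → (ℕtoℚ a ÷' (1ℚ ℚ.- q̄)) ℚ.≤ ℕtoℚ r → a * d ≤ r * suc δ
  ÷[1-q̄]≤⇒ a r a÷[1-q̄]≤r =
    subst (_≤ r * suc δ) (*-identityʳ (a * d)) (Equivalence.to (≤⇔frac-≤ a÷[1-q̄]≃ (toℚᵘ-ℕtoℚ r)) a÷[1-q̄]≤r)
    where
      open ℚᵘ.≃-Reasoning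
      a÷[1-q̄]≃ : toℚᵘ (ℕtoℚ a ÷' (1ℚ ℚ.- q̄)) ℚᵘ.≃ frac (a * d) δ
      a÷[1-q̄]≃ = begin
        toℚᵘ (ℕtoℚ a ÷' (1ℚ ℚ.- q̄)) ≈⟨ toℚᵘ-÷′ (toℚᵘ-ℕtoℚ a) 1-q̄≃ ⟩
        frac a 0 ℚᵘ.* frac d δ       ≡⟨ frac-*ˡ a d δ ⟩
        frac (a * d) δ               ∎

  p*T+[1+δ]*T≡d*T : ∀ T → p * T + suc δ * T ≡ d * T
  p*T+[1+δ]*T≡d*T T = trans (sym (*-distribʳ-+ T p (suc δ))) (cong (_* T) (sym d≡p+1+δ))

  quota<total : ∀ {T Q} → CeilDiv (p * T) d Q → d ≤ suc δ * T → Q < T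
  quota<total {T} {Q} (_ , Qd<pT+d) d≤[1+δ]T = *-cancelʳ-< d Q T (begin-strict
    Q * d             <⟨ Qd<pT+d ⟩
    p * T + d         ≤⟨ +-monoʳ-≤ (p * T) d≤[1+δ]T ⟩
    p * T + suc δ * T ≡⟨ p*T+[1+δ]*T≡d*T T ⟩
    d * T             ≡⟨ *-comm d T ⟩
    T * d             ∎)
    where open ≤-Reasoning

  slack : ∀ {T Q D} → CeilDiv (p * T) d Q → Q + D ≡ T → suc δ * T < d * suc D
  slack {T} {Q} {D} (_ , Qd<pT+d) Q+D≡T = +-cancelˡ-< (p * T) (suc δ * T) (d * suc D) (begin-strict
    p * T + suc δ * T ≡⟨ p*T+[1+δ]*T≡d*T T ⟩
    d * T             ≡⟨ cong (d *_) Q+D≡T ⟨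
    d * (Q + D)       ≡⟨ trans (*-distribˡ-+ d Q D) (cong (_+ d * D) (*-comm d Q)) ⟩
    Q * d + d * D     <⟨ +-monoˡ-< (d * D) Qd<pT+d ⟩
    p * T + d + d * D ≡⟨ trans (+-assoc (p * T) d (d * D)) (cong (λ z → p * T + z) (sym (*-suc d D))) ⟩
    p * T + d * suc D ∎)
    where open ≤-Reasoning

  nakamura-via-packings : ∀ {N} (v : Vec ℕ N) {T} → sumV v ≡ T → d ≤ suc δ * T →
    (∀ {D k} → 1 ≤ D → 1 ≤ k → suc δ * T < d * suc D → CeilDiv T D k → Packing v k (λ _ → D)) →
    ∃[ k ] (+ k ≡ nakamuraFormula q̄ T × NakamuraIs [ q̄ ℚ.* ℕtoℚ T ⨾ v ] (fin k))
  nakamura-via-packings v {T} sum≡T d≤[1+δ]T packing = k , formula ,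
    packing⇒nakamuraIs (hasQuota v T ceilQ) (trans sum≡T (sym Q+D≡T))
      (subst (λ n → CeilDiv n D k) (sym sum≡T) ceilK)
      (packing 1≤D (ceilDiv-pos 1≤T ceilK) (slack ceilQ Q+D≡T) ceilK)
    where
      Q = proj₁ (ceilDiv (p * T) d)
      ceilQ : CeilDiv (p * T) d Q
      ceilQ = proj₂ (ceilDiv (p * T) d)
      Q<T : Q < T
      Q<T = quota<total ceilQ d≤[1+δ]T
      1≤T : 1 ≤ T
      1≤T = ≤-trans (s≤s z≤n) Q<T
      D = T ∸ Q
      Q+D≡T : Q + D ≡ T
      Q+D≡T = m+[n∸m]≡n (<⇒≤ Q<T)
      1≤D : 1 ≤ D
      1≤D = m<n⇒0<n∸m Q<T
      k = proj₁ (ceilDiv T D {{>-nonZero 1≤D}})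
      ceilK : CeilDiv T D k
      ceilK = proj₂ (ceilDiv T D {{>-nonZero 1≤D}})
      ceiling-quota : ceiling (q̄ ℚ.* ℕtoℚ T) ≡ + Q
      ceiling-quota = ceiling-≃ _ (quota-≃ p d₋ coprime T) (*-mono-≤ 1≤p 1≤T) ceilQ
      formula : + k ≡ nakamuraFormula q̄ T
      formula = sym (trans (cong (λ z → ceiling (1ℚ ÷' (1ℚ ℚ.- ((z ℚ./ 1) ÷' ℕtoℚ T)))) ceiling-quota)
                           (ceiling-1÷[1-Q÷T] Q+D≡T 1≤D ceilK))

  nakamura-with-units : ∀ {N} (w : Vec ℕ N) x → All (_≤ x) w → ∀ r → sumV w ≤ r →
    (ℕtoℚ (2 + x) ÷' (1ℚ ℚ.- q̄)) ℚ.≤ ℕtoℚ r →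
    ∃[ k ] (+ k ≡ nakamuraFormula q̄ (sumV w + r) ×
            NakamuraIs [ q̄ ℚ.* ℕtoℚ (sumV w + r) ⨾ w ++ replicate r 1 ] (fin k))
  nakamura-with-units w x w≤x r Ω≤r bound = nakamura-via-packings (w ++ replicate r 1) sum≡T
    (≤-trans (m≤n*m d (2 + x)) (≤-trans [2+x]d≤T[1+δ] (≤-reflexive (*-comm T (suc δ))))) packing
    where
      open ≤-Reasoning
      T = sumV w + r
      [2+x]d≤T[1+δ] : (2 + x) * d ≤ T * suc δ
      [2+x]d≤T[1+δ] = ≤-trans (÷[1-q̄]≤⇒ (2 + x) r bound) (*-monoˡ-≤ (suc δ) (m≤n+m r (sumV w)))
      2Ω≤T : 2 * sumV w ≤ T
      2Ω≤T = +-monoʳ-≤ (sumV w) (≤-trans (≤-reflexive (+-identityʳ (sumV w))) Ω≤r)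
      sum≡T : sumV (w ++ replicate r 1) ≡ T
      sum≡T = trans (sumV-++ w (replicate r 1))
                    (cong (λ z → sumV w + z) (trans (sumV-replicate r 1) (*-identityʳ r)))
      packing : ∀ {D k} → 1 ≤ D → 1 ≤ k → suc δ * T < d * suc D → CeilDiv T D k →
        Packing (w ++ replicate r 1) k (λ _ → D)
      packing {D} {k} _ 1≤k slack (T≤kD , _) =
        packing-with-units w r (All.map (λ wᵢ≤x → ≤-trans wᵢ≤x x≤D) w≤x) 1≤k (≤-trans 2Ω≤T T≤kD) T≤kD
        where
          2+x<1+D : 2 + x < suc D
          2+x<1+D = *-cancelˡ-< d (2 + x) (suc D) (begin-strict
            d * (2 + x) ≡⟨ *-comm d (2 + x) ⟩
            (2 + x) * d ≤⟨ [2+x]d≤T[1+δ] ⟩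
            T * suc δ   ≡⟨ *-comm T (suc δ) ⟩
            suc δ * T   <⟨ slack ⟩
            d * suc D   ∎)
          x≤D : x ≤ D
          x≤D = m+n≤o⇒n≤o 2 (≤-pred 2+x<1+D)

  nakamura-replicated : ∀ {n} (w : Vec ℕ n) → 1 ≤ sumV w → gcdV w ≡ 1 →
    ∃[ R ] (∀ r → R ≤ r → ∃[ k ] (+ k ≡ nakamuraFormula q̄ (sumV w * r) ×
            NakamuraIs [ q̄ ℚ.* ℕtoℚ (sumV w * r) ⨾ concat (map (replicate r) w) ] (fin k)))
  nakamura-replicated w 1≤Ω gcd≡1 = d + K * threshold w u u′ K , λ r R≤r →
    nakamura-via-packings (concat (map (replicate r) w)) (sumV-concat-replicate r w)
      (≤-trans (m+n≤o⇒m≤o d R≤r) (≤-trans (r≤Ωr r) (m≤n*m (sumV w * r) (suc δ))))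
      (packing r (m+n≤o⇒n≤o d R≤r))
    where
      instance _ = >-nonZero 1≤Ω
      K = 2 * d
      u = proj₁ (bezout w)
      u′ = proj₁ (proj₂ (bezout w))
      wu≡wu′+1 : w · u ≡ w · u′ + 1
      wu≡wu′+1 = subst (λ g → w · u ≡ w · u′ + g) gcd≡1 (proj₂ (proj₂ (bezout w)))
      r≤Ωr : ∀ r → r ≤ sumV w * r
      r≤Ωr r = m≤n*m r (sumV w)
      packing : ∀ r → K * threshold w u u′ K ≤ r → ∀ {D k} → 1 ≤ D → 1 ≤ k →
        suc δ * (sumV w * r) < d * suc D → CeilDiv (sumV w * r) D k →
        Packing (concat (map (replicate r) w)) k (λ _ → D)
      packing r KX≤r 1≤D 1≤k slack ceil = packing-replicated-large w u u′ K 1≤Ω wu≡wu′+1 r KX≤r 1≤k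
        (ceilDiv≤2* d 1≤D (≤-<-trans (m≤n*m (sumV w * r) (suc δ)) slack) ceil) ceil

mkℚ<1⇒≤ : ∀ {p d₋} .{coprime : Coprime p (suc d₋)} → mkℚ (+ p) d₋ coprime ℚ.< 1ℚ → p ≤ d₋
mkℚ<1⇒≤ {p} {d₋} (ℚ.*<* p*1<1*d) = ≤-pred (subst₂ _<_ (*-identityʳ p) (*-identityˡ (suc d₋))
  (ℤ.drop‿+<+ (subst₂ ℤ._<_ (sym (ℤ.pos-* p 1)) (sym (ℤ.pos-* 1 (suc d₋))) p*1<1*d)))

theorem2 : (m : ℕ) (w : Vec ℕ (suc m)) (q̄ : ℚ) →
  (∀ (i j : Fin (suc m)) → i Fin.≤ j → lookup w j ℕ.≤ lookup w i) →
  (∀ (i : Fin (suc m)) → 1 ℕ.≤ lookup w i) →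
  gcdV w ≡ 1 →
  0ℚ ℚ.< q̄ → q̄ ℚ.< 1ℚ →
  ((r : ℕ) → 1 ℕ.≤ r → sumV w ℕ.≤ r →
     (ℕtoℚ (2 + head w) ÷' (1ℚ - q̄)) ℚ.≤ ℕtoℚ r →
     ∃[ k ] ((+ k ≡ ceiling (1ℚ ÷' (1ℚ - ((ceiling (q̄ ℚ.* ℕtoℚ (sumV w + r)) / 1) ÷' ℕtoℚ (sumV w + r)))))
            × NakamuraIs [ q̄ ℚ.* ℕtoℚ (sumV w + r) ⨾ w ++ replicate r 1 ] (fin k)))
  × (∃[ R ] ((r : ℕ) → 1 ℕ.≤ r → R ℕ.≤ r →
     ∃[ k ] ((+ k ≡ ceiling (1ℚ ÷' (1ℚ - ((ceiling (q̄ ℚ.* ℕtoℚ (sumV w * r)) / 1) ÷' ℕtoℚ (sumV w * r)))))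
            × NakamuraIs [ q̄ ℚ.* ℕtoℚ (sumV w * r) ⨾ concat (map (replicate r) w) ] (fin k))))
theorem2 m (x ∷ xs) (mkℚ +[1+ p₋ ] d₋ coprime) sorted positive gcd≡1 _ q̄<1 =
  (λ r _ Ω≤r bound → nakamura-with-units (x ∷ xs) x x-max r Ω≤r bound) ,
  map₂ (λ nakamura r _ → nakamura r)
    (nakamura-replicated (x ∷ xs) (≤-trans (positive Fin.zero) (m≤m+n x (sumV xs))) gcd≡1)
  where
    open Ratio (suc p₋) d₋ coprime (s≤s z≤n) (mkℚ<1⇒≤ q̄<1)
    x-max : All (_≤ x) (x ∷ xs)
    x-max = lookup⁻ (λ i → sorted Fin.zero i z≤n)
theorem2 m w (mkℚ (+ zero) d₋ _) _ _ _ (ℚ.*<* (ℤ.+<+ ())) _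
theorem2 m w (mkℚ -[1+ n ] d₋ _) _ _ _ (ℚ.*<* ()) _
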